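{- No element of $\mathcal{D}'$ lies in the open interval $\left(\sqrt3,\ \frac{7+\sqrt{13}}{6}\right)$.
   Context: The empty word is a palindrome. For an infinite word $w$ with infinitely many palindromic prefixes, $(n_i)_{i\ge1}$ is the increasing sequence of lengths of its palindromic prefixes ($n_1=0$) and $\delta(w)=\limsup n_{i+1}/n_i$. Characteristic Sturmian words: on $\{a,b\}$, for positive integers $s_1,s_2,\dots$, put $\sigma_0=a$, $\sigma_1=a^{s_1-1}b$, $\sigma_n=\sigma_{n-1}^{s_n}\sigma_{n-2}$ ($n\ge2$); the limit of $(\sigma_n)$ is the characteristic Sturmian word of slope $[0,s_1,s_2,\dots]$. $\mathcal{D}'$ is the set of values $\delta(w)$ where $w$ is either a periodic word $uuu\cdots$ with $u$ a non-empty palindrome, or a characteristic Sturmian word. -}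

module Defs where

open import Data.Nat using (ℕ; zero; suc; _+_; _*_; _∸_; _≤_; _<_)
open import Data.List using (List; []; _∷_; _++_; replicate; concat; length; reverse)
open import Data.Maybe using (Maybe; just; nothing)
open import Data.Bool using (Bool; true; false)
open import Data.Product using (Σ; ∃; _×_; _,_)
open import Data.Sum using (_⊎_)
open import Relation.Binary.PropositionalEquality using (_≡_; _≢_)
open import Relation.Nullary using (¬_)

_‼_ : {A : Set} → List A → ℕ → Maybe A
[] ‼ _ = nothing
(x ∷ xs) ‼ zero = just x
(x ∷ xs) ‼ suc k = xs ‼ k

PalPrefix : {A : Set} → (ℕ → A) → ℕ → Set
PalPrefix w n = ∀ k → k < n → w k ≡ w (n ∸ suc k)

-- n enumerates (0-indexed: n 0 = n_1 = 0) in increasing order exactly the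
-- lengths of the palindromic prefixes of w.
IsPalPrefixLengths : {A : Set} → (ℕ → A) → (ℕ → ℕ) → Set
IsPalPrefixLengths w n =
  (n 0 ≡ 0)
  × (∀ i → n i < n (suc i))
  × (∀ i → PalPrefix w (n i))
  × (∀ m → PalPrefix w m → ∃ λ i → n i ≡ m)

-- δ = limsup n(i+1)/n(i) > √3 : some rational p/d with (p/d)² > 3 is
-- exceeded by the ratio infinitely often.
DeltaAboveSqrt3 : (ℕ → ℕ) → Set
DeltaAboveSqrt3 n = Σ ℕ λ p → Σ ℕ λ d → (0 < d) × (3 * (d * d) < p * p)
  × (∀ N → ∃ λ i → (N ≤ i) × (p * n i < d * n (suc i)))

-- p/d < (7+√13)/6  ⇔  (6p ∸ 7d)² < 13 d²   (for d > 0)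
BelowC : ℕ → ℕ → Set
BelowC p d = (6 * p ∸ 7 * d) * (6 * p ∸ 7 * d) < 13 * (d * d)

-- δ = limsup n(i+1)/n(i) < (7+√13)/6 : eventually the ratio stays below
-- some rational p/d < (7+√13)/6.
DeltaBelowC : (ℕ → ℕ) → Set
DeltaBelowC n = Σ ℕ λ p → Σ ℕ λ d → (0 < d) × BelowC p d
  × (∃ λ N → ∀ i → N ≤ i → d * n (suc i) < p * n i)

DeltaInInterval : (ℕ → ℕ) → Set
DeltaInInterval n = DeltaAboveSqrt3 n × DeltaBelowC n

IsPalPeriodic : {A : Set} → List A → (ℕ → A) → Set
IsPalPeriodic u w = (u ≢ []) × (reverse u ≡ u)
  × (∀ k → k < length u → u ‼ k ≡ just (w k))
  × (∀ k → w (k + length u) ≡ w k)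

-- a = false, b = true.  s k is s_k for k ≥ 1 (s 0 unused).
σ : (ℕ → ℕ) → ℕ → List Bool
σ s zero = false ∷ []
σ s (suc zero) = replicate (s 1 ∸ 1) false ++ (true ∷ [])
σ s (suc (suc m)) = concat (replicate (s (suc (suc m))) (σ s (suc m))) ++ σ s m

IsCharSturmian : (ℕ → ℕ) → (ℕ → Bool) → Set
IsCharSturmian s w = ∀ k → ∃ λ N → ∀ m → N ≤ m → σ s m ‼ k ≡ just (w k)

{-# OPTIONS --safe #-}
-- For u^ω with u a palindrome every multiple of |u| is a palindromic prefix length, so the
-- gaps n_{i+1} − n_i are bounded and δ = 1.
--
-- For a characteristic Sturmian word let q_m = |σ_m| and let c_m be the central word, with
-- σ_{m+1} σ_m = c_m x y.  From c_3 on, the palindromic prefixes are exactly the words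
-- σ_{m+1}^k c_m (0 ≤ k ≤ s_{m+2}): these are palindromes because σ_{m+1} c_m = c_m σ̃_{m+1}
-- (σ̃ the reversal of σ), and there are no others by Fine–Wilf and gcd(q_{m+1}, q_m) = 1.
-- Hence n_{i+1}/n_i is largest at k = 0, where it is about (2x + 1)/(x + 1) with
-- x = q_{m+1}/q_m.  If δ < (7 + √13)/6 then eventually x < (3 + √13)/2, which forces
-- s_m ≤ 2 for all large m; then x ≤ 1 + √3 up to o(1), and so δ ≤ √3.
module Submission where

open import Defs
open import Data.Bool using (Bool; false)
open import Data.Empty using (⊥; ⊥-elim)
open import Function using (_∘_)
open import Data.List using (List; []; _∷_; _++_; replicate; concat; length; reverse)
open import Data.List.Properties
  using (++-assoc; ++-identityʳ; length-++; length-replicate; length-reverse;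
         reverse-++; unfold-reverse)
open import Data.Maybe using (just)
open import Data.Maybe.Properties using (just-injective)
open import Data.Nat
  using (ℕ; zero; suc; _+_; _*_; _∸_; _≤_; _<_; z≤n; s≤s; z<s; NonZero; >-nonZero; pred)
open import Data.Nat.Coprimality using (Coprime)
open import Data.Nat.Divisibility
  using (_∣_; ∣-refl; ∣-trans; ∣m∣n⇒∣m+n; ∣m+n∣m⇒∣n; ∣n⇒∣m*n; ∣⇒≤; ∣1⇒≡1)
open import Data.Nat.DivMod using (_/_; _%_; m≡m%n+[m/n]*n; m%n<n; m/n*n≤m)
open import Data.Nat.Induction using (<-wellFounded)
open import Data.Nat.Properties
open import Data.Nat.Tactic.RingSolver using (solve-∀)
open import Data.Product using (∃; _×_; _,_; proj₁; proj₂; map₂)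
open import Data.Sum using (inj₁; inj₂)
open import Induction.WellFounded using (Acc; acc)
open import Relation.Binary.Definitions using (tri<; tri≈; tri>)
open import Relation.Binary.PropositionalEquality
open import Relation.Nullary using (¬_; yes; no)

-- Words

module _ {A : Set} where

  ‼-++ˡ : (xs ys : List A) {k : ℕ} → k < length xs → (xs ++ ys) ‼ k ≡ xs ‼ k
  ‼-++ˡ (x ∷ xs) ys {zero}  _         = refl
  ‼-++ˡ (x ∷ xs) ys {suc k} (s≤s k<n) = ‼-++ˡ xs ys k<n

  ‼-++ʳ : (xs ys : List A) (k : ℕ) → (xs ++ ys) ‼ (length xs + k) ≡ ys ‼ k
  ‼-++ʳ []       ys k = refl
  ‼-++ʳ (x ∷ xs) ys k = ‼-++ʳ xs ys k

  ‼-reverse : (xs : List A) {k : ℕ} → k < length xs →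
              reverse xs ‼ k ≡ xs ‼ (length xs ∸ suc k)
  ‼-reverse (x ∷ xs) {k} k<1+n rewrite unfold-reverse x xs with m≤n⇒m<n∨m≡n (≤-pred k<1+n)
  ... | inj₁ k<n = begin
    (reverse xs ++ x ∷ []) ‼ k  ≡⟨ ‼-++ˡ (reverse xs) (x ∷ []) (subst (k <_) (sym (length-reverse xs)) k<n) ⟩
    reverse xs ‼ k              ≡⟨ ‼-reverse xs k<n ⟩
    xs ‼ (length xs ∸ suc k)    ≡⟨ cong ((x ∷ xs) ‼_) (+-∸-assoc 1 k<n) ⟨
    (x ∷ xs) ‼ (length xs ∸ k)  ∎
    where open ≡-Reasoning
  ... | inj₂ refl = begin
    (reverse xs ++ x ∷ []) ‼ length xs
      ≡⟨ cong ((reverse xs ++ x ∷ []) ‼_) (trans (+-identityʳ _) (length-reverse xs)) ⟨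
    (reverse xs ++ x ∷ []) ‼ (length (reverse xs) + 0)  ≡⟨ ‼-++ʳ (reverse xs) (x ∷ []) 0 ⟩
    just x                                              ≡⟨ cong ((x ∷ xs) ‼_) (n∸n≡0 (length xs)) ⟨
    (x ∷ xs) ‼ (length xs ∸ length xs)                  ∎
    where open ≡-Reasoning

  infixl 8 _^_
  _^_ : List A → ℕ → List A
  t ^ k = concat (replicate k t)

  length-^ : (t : List A) (k : ℕ) → length (t ^ k) ≡ k * length t
  length-^ t zero    = refl
  length-^ t (suc k) = trans (length-++ t) (cong (length t +_) (length-^ t k))

  ^-+ : (t : List A) (j k : ℕ) → t ^ (j + k) ≡ t ^ j ++ t ^ k
  ^-+ t zero    k = refl
  ^-+ t (suc j) k = trans (cong (t ++_) (^-+ t j k)) (sym (++-assoc t (t ^ j) (t ^ k)))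

  ^-conjugate : {t t′ X : List A} → t ++ X ≡ X ++ t′ → ∀ k → t ^ k ++ X ≡ X ++ t′ ^ k
  ^-conjugate {X = X} _ zero = sym (++-identityʳ X)
  ^-conjugate {t} {t′} {X} tX≡Xt′ (suc k) = begin
    (t ++ t ^ k) ++ X    ≡⟨ ++-assoc t (t ^ k) X ⟩
    t ++ (t ^ k ++ X)    ≡⟨ cong (t ++_) (^-conjugate tX≡Xt′ k) ⟩
    t ++ (X ++ t′ ^ k)   ≡⟨ ++-assoc t X (t′ ^ k) ⟨
    (t ++ X) ++ t′ ^ k   ≡⟨ cong (_++ t′ ^ k) tX≡Xt′ ⟩
    (X ++ t′) ++ t′ ^ k  ≡⟨ ++-assoc X t′ (t′ ^ k) ⟩
    X ++ (t′ ++ t′ ^ k)  ∎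
    where open ≡-Reasoning

  reverse-^ : (t : List A) (k : ℕ) → reverse (t ^ k) ≡ reverse t ^ k
  reverse-^ t zero    = refl
  reverse-^ t (suc k) = begin
    reverse (t ++ t ^ k)          ≡⟨ reverse-++ t (t ^ k) ⟩
    reverse (t ^ k) ++ reverse t  ≡⟨ cong (_++ reverse t) (reverse-^ t k) ⟩
    reverse t ^ k ++ reverse t    ≡⟨ ^-conjugate refl k ⟩
    reverse t ++ reverse t ^ k    ∎
    where open ≡-Reasoning

  replicate-snoc : (k : ℕ) (a : A) → a ∷ replicate k a ≡ replicate k a ++ a ∷ []
  replicate-snoc zero    a = refl
  replicate-snoc (suc k) a = cong (a ∷_) (replicate-snoc k a)

  reverse-replicate : (k : ℕ) (a : A) → reverse (replicate k a) ≡ replicate k a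
  reverse-replicate zero    a = refl
  reverse-replicate (suc k) a = begin
    reverse (a ∷ replicate k a)         ≡⟨ unfold-reverse a (replicate k a) ⟩
    reverse (replicate k a) ++ a ∷ []   ≡⟨ cong (_++ a ∷ []) (reverse-replicate k a) ⟩
    replicate k a ++ a ∷ []             ≡⟨ replicate-snoc k a ⟨
    a ∷ replicate k a                   ∎
    where open ≡-Reasoning

  infix 4 _≼_ _⊑_

  _≼_ : List A → List A → Set
  Z ≼ T = ∃ λ R → T ≡ Z ++ R

  ≼-trans : {Z T U : List A} → Z ≼ T → T ≼ U → Z ≼ U
  ≼-trans {Z} (R , refl) (R′ , refl) = R ++ R′ , ++-assoc Z R R′

  _⊑_ : List A → (ℕ → A) → Set
  Z ⊑ w = ∀ k → k < length Z → Z ‼ k ≡ just (w k)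

  ≼-‼ : {Z T : List A} {k : ℕ} → Z ≼ T → k < length Z → T ‼ k ≡ Z ‼ k
  ≼-‼ {Z} (R , refl) = ‼-++ˡ Z R

  ≼-length : {Z T : List A} → Z ≼ T → length Z ≤ length T
  ≼-length {Z} (R , refl) = subst (length Z ≤_) (sym (length-++ Z)) (m≤m+n _ _)

  ≼-⊑ : {Z T : List A} {w : ℕ → A} → Z ≼ T → T ⊑ w → Z ⊑ w
  ≼-⊑ Z≼T T⊑w k k<|Z| = trans (sym (≼-‼ Z≼T k<|Z|)) (T⊑w k (<-≤-trans k<|Z| (≼-length Z≼T)))

  ⊑-letter : (Z R : List A) {w : ℕ → A} {k : ℕ} → Z ++ R ⊑ w → k < length R →
             R ‼ k ≡ just (w (length Z + k))
  ⊑-letter Z R ZR⊑w k<|R| =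
    trans (sym (‼-++ʳ Z R _))
          (ZR⊑w _ (subst (_ <_) (sym (length-++ Z)) (+-monoʳ-< (length Z) k<|R|)))

  palindrome⇒PalPrefix : (Z : List A) {w : ℕ → A} → reverse Z ≡ Z → Z ⊑ w → PalPrefix w (length Z)
  palindrome⇒PalPrefix Z {w} Zʳ≡Z Z⊑w k k<|Z| = just-injective (begin
    just (w k)                  ≡⟨ Z⊑w k k<|Z| ⟨
    Z ‼ k                       ≡⟨ cong (_‼ k) Zʳ≡Z ⟨
    reverse Z ‼ k               ≡⟨ ‼-reverse Z k<|Z| ⟩
    Z ‼ (length Z ∸ suc k)      ≡⟨ Z⊑w _ (∸-monoʳ-< {o = 0} z<s k<|Z|) ⟩
    just (w (length Z ∸ suc k)) ∎)
    where open ≡-Reasoning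

module _ {A : Set} (u : ℕ → List A) (u-grows : ∀ m → u m ≼ u (suc m)) where

  ≼-chain : ∀ m j → u m ≼ u (j + m)
  ≼-chain m zero    = [] , sym (++-identityʳ (u m))
  ≼-chain m (suc j) = ≼-trans (≼-chain m j) (u-grows (j + m))

  ⊑-limit : {w : ℕ → A} → (∀ k → ∃ λ N → ∀ m → N ≤ m → u m ‼ k ≡ just (w k)) → ∀ m → u m ⊑ w
  ⊑-limit lim m k k<|um| with lim k
  ... | N , u≥N‼k = trans (sym (≼-‼ (≼-chain m N) k<|um|)) (u≥N‼k (N + m) (m≤m+n N m))

module _ (f : ℕ → ℕ) where

  stepwise-mono-≤ : (∀ i → f i ≤ f (suc i)) → ∀ {i j} → i ≤ j → f i ≤ f j
  stepwise-mono-≤ f-step {j = zero} z≤n = ≤-refl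
  stepwise-mono-≤ f-step {i} {suc j} i≤1+j with m≤n⇒m<n∨m≡n i≤1+j
  ... | inj₁ (s≤s i≤j) = ≤-trans (stepwise-mono-≤ f-step i≤j) (f-step j)
  ... | inj₂ refl      = ≤-refl

  stepwise-mono-< : (∀ i → f i < f (suc i)) → ∀ {i j} → i < j → f i < f j
  stepwise-mono-< f-step {j = suc j} (s≤s i≤j) =
    ≤-<-trans (stepwise-mono-≤ (λ k → <⇒≤ (f-step k)) i≤j) (f-step j)

module PalPrefixLengths {A : Set} {w : ℕ → A} {n : ℕ → ℕ} (E : IsPalPrefixLengths w n) where

  n-step : ∀ i → n i < n (suc i)
  n-step = proj₁ (proj₂ E)

  n-pal : ∀ i → PalPrefix w (n i)
  n-pal = proj₁ (proj₂ (proj₂ E))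

  n-complete : ∀ m → PalPrefix w m → ∃ λ i → n i ≡ m
  n-complete = proj₂ (proj₂ (proj₂ E))

  n-mono-≤ : ∀ {i j} → i ≤ j → n i ≤ n j
  n-mono-≤ = stepwise-mono-≤ n (λ i → <⇒≤ (n-step i))

  n-mono-< : ∀ {i j} → i < j → n i < n j
  n-mono-< = stepwise-mono-< n n-step

  n-cancel-≤ : ∀ {i j} → n i ≤ n j → i ≤ j
  n-cancel-≤ ni≤nj = ≮⇒≥ (λ j<i → <⇒≱ (n-mono-< j<i) ni≤nj)

  n-cancel-< : ∀ {i j} → n i < n j → i < j
  n-cancel-< ni<nj = ≰⇒> (λ j≤i → <⇒≱ ni<nj (n-mono-≤ j≤i))

  i≤n[i] : ∀ i → i ≤ n i
  i≤n[i] zero    = z≤n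
  i≤n[i] (suc i) = <-≤-trans (s≤s (i≤n[i] i)) (n-step i)

  n-next-≤ : ∀ i m → PalPrefix w m → n i < m → n (suc i) ≤ m
  n-next-≤ i m pal-m ni<m with n-complete _ pal-m
  ... | j , refl = n-mono-≤ (n-cancel-< ni<m)

-- Periodic words

m<[1+m/n]*n : ∀ m n .{{_ : NonZero n}} → m < suc (m / n) * n
m<[1+m/n]*n m n = begin-strict
  m                    ≡⟨ m≡m%n+[m/n]*n m n ⟩
  m % n + (m / n) * n  <⟨ +-monoˡ-< ((m / n) * n) (m%n<n m n) ⟩
  suc (m / n) * n      ∎
  where open ≤-Reasoning

[1+m/n]*n≤m+n : ∀ m n .{{_ : NonZero n}} → suc (m / n) * n ≤ m + n
[1+m/n]*n≤m+n m n = begin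
  n + (m / n) * n  ≤⟨ +-monoʳ-≤ n (m/n*n≤m m n) ⟩
  n + m            ≡⟨ +-comm n m ⟩
  m + n            ∎
  where open ≤-Reasoning

3d²<p²⇒d<p : ∀ p d → 3 * (d * d) < p * p → d < p
3d²<p²⇒d<p p d 3d²<p² =
  ≰⇒> (λ p≤d → <⇒≱ 3d²<p² (≤-trans (*-mono-≤ p≤d p≤d) (m≤n*m (d * d) 3)))

boundedGaps⇒¬DeltaAboveSqrt3 : ∀ {n} L → (∀ i → i ≤ n i) → (∀ i → n (suc i) ≤ n i + L) →
                               ¬ DeltaAboveSqrt3 n
boundedGaps⇒¬DeltaAboveSqrt3 {n} L i≤n[i] gap (p , d , _ , 3d²<p² , often) with often (d * L)
... | i , dL≤i , pn<dn′ = <⇒≱ pn<dn′ (begin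
  d * n (suc i)    ≤⟨ *-monoʳ-≤ d (gap i) ⟩
  d * (n i + L)    ≡⟨ *-distribˡ-+ d (n i) L ⟩
  d * n i + d * L  ≤⟨ +-monoʳ-≤ (d * n i) (≤-trans dL≤i (i≤n[i] i)) ⟩
  d * n i + n i    ≡⟨ +-comm (d * n i) (n i) ⟩
  suc d * n i      ≤⟨ *-monoˡ-≤ (n i) (3d²<p²⇒d<p p d 3d²<p²) ⟩
  p * n i          ∎)
  where open ≤-Reasoning

^-⊑ : {A : Set} {u : List A} {w : ℕ → A} → u ⊑ w → (∀ k → w (k + length u) ≡ w k) →
      ∀ c → u ^ c ⊑ w
^-⊑ {u = u} {w} u⊑w w-periodic (suc c) k k<|uuᶜ| with k <? length u
... | yes k<|u| = trans (‼-++ˡ u (u ^ c) k<|u|) (u⊑w k k<|u|)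
... | no k≮|u| with m≤n⇒∃[o]m+o≡n (≮⇒≥ k≮|u|)
...   | o , refl = begin
  (u ++ u ^ c) ‼ (length u + o)  ≡⟨ ‼-++ʳ u (u ^ c) o ⟩
  (u ^ c) ‼ o                    ≡⟨ ^-⊑ u⊑w w-periodic c o o<|uᶜ| ⟩
  just (w o)                     ≡⟨ cong just (trans (sym (w-periodic o)) (cong w (+-comm o (length u)))) ⟩
  just (w (length u + o))        ∎
  where
    open ≡-Reasoning
    o<|uᶜ| : o < length (u ^ c)
    o<|uᶜ| = +-cancelˡ-< (length u) o _ (subst (length u + o <_) (length-++ u) k<|uuᶜ|)

palPeriodic-¬DeltaInInterval : {A : Set} (u : List A) (w : ℕ → A) → IsPalPeriodic u w →
                               ∀ n → IsPalPrefixLengths w n → ¬ DeltaInInterval n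
palPeriodic-¬DeltaInInterval []          w (u≢[] , _) = ⊥-elim (u≢[] refl)
palPeriodic-¬DeltaInInterval u@(_ ∷ _) w (_ , uʳ≡u , u⊑w , w-periodic) n E (above , _) =
  boundedGaps⇒¬DeltaAboveSqrt3 (length u) i≤n[i] gap above
  where
    open PalPrefixLengths E
    pal-multiple : ∀ c → PalPrefix w (c * length u)
    pal-multiple c = subst (PalPrefix w) (length-^ u c)
      (palindrome⇒PalPrefix (u ^ c) (trans (reverse-^ u c) (cong (_^ c) uʳ≡u)) (^-⊑ u⊑w w-periodic c))
    gap : ∀ i → n (suc i) ≤ n i + length u
    gap i = ≤-trans (n-next-≤ i _ (pal-multiple (suc (n i / length u))) (m<[1+m/n]*n (n i) (length u)))
                    ([1+m/n]*n≤m+n (n i) (length u))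

-- Periods

HasPeriod : {A : Set} → (ℕ → A) → ℕ → ℕ → Set
HasPeriod w L p = ∀ i → i + p < L → w i ≡ w (i + p)

module _ {A : Set} (w : ℕ → A) where

  HasPeriod-≤ : ∀ {L M p} → L ≤ M → HasPeriod w M p → HasPeriod w L p
  HasPeriod-≤ L≤M per i i+p<L = per i (<-≤-trans i+p<L L≤M)

  palPrefixes⇒period : ∀ y o → PalPrefix w y → PalPrefix w (y + o) → HasPeriod w (y + o) o
  palPrefixes⇒period y o pal-y pal-y+o i i+o<y+o with m≤n⇒∃[o]m+o≡n (+-cancelʳ-< o i y i+o<y+o)
  ... | a , refl = begin
    w i                          ≡⟨ pal-y i (m≤m+n (suc i) a) ⟩
    w (suc i + a ∸ suc i)        ≡⟨ cong w (m+n∸m≡n (suc i) a) ⟩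
    w a                          ≡⟨ pal-y+o a (≤-trans (s≤s (m≤n+m a i)) (m≤m+n (suc i + a) o)) ⟩
    w (suc i + a + o ∸ suc a)    ≡⟨ cong (λ z → w (z ∸ suc a)) (reorder i a o) ⟩
    w (suc a + (i + o) ∸ suc a)  ≡⟨ cong w (m+n∸m≡n (suc a) (i + o)) ⟩
    w (i + o)                    ∎
    where
      open ≡-Reasoning
      reorder : ∀ i a o → suc i + a + o ≡ suc a + (i + o)
      reorder = solve-∀

  period-difference : ∀ {L} p r → HasPeriod w L p → HasPeriod w L (p + r) → p + (p + r) ≤ L →
                      HasPeriod w L r
  period-difference {L} p r per-p per-p+r 2p+r≤L i i+r<L with i + (p + r) <? L
  ... | yes i+p+r<L = begin
    w i              ≡⟨ per-p+r i i+p+r<L ⟩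
    w (i + (p + r))  ≡⟨ cong w (reorder i p r) ⟩
    w (i + r + p)    ≡⟨ per-p (i + r) (subst (_< L) (reorder i p r) i+p+r<L) ⟨
    w (i + r)        ∎
    where
      open ≡-Reasoning
      reorder : ∀ i p r → i + (p + r) ≡ i + r + p
      reorder = solve-∀
  ... | no i+p+r≮L with m≤n⇒∃[o]m+o≡n (+-cancelʳ-≤ (p + r) p i (≤-trans 2p+r≤L (≮⇒≥ i+p+r≮L)))
  ...   | j , refl = begin
    w (p + j)        ≡⟨ cong w (+-comm p j) ⟩
    w (j + p)        ≡⟨ per-p j (subst (_< L) (+-comm p j) (≤-<-trans (m≤m+n (p + j) r) i+r<L)) ⟨
    w j              ≡⟨ per-p+r j (subst (_< L) (sym (reorder j p r)) i+r<L) ⟩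
    w (j + (p + r))  ≡⟨ cong w (reorder j p r) ⟩
    w (p + j + r)    ∎
    where
      open ≡-Reasoning
      reorder : ∀ j p r → j + (p + r) ≡ p + j + r
      reorder = solve-∀

  fine-wilf : ∀ {L} p q → HasPeriod w L p → HasPeriod w L q → 0 < p → 0 < q → p + q ≤ L →
              ∃ λ g → 0 < g × g ∣ p × g ∣ q × HasPeriod w L g
  fine-wilf p q = euclid p q (<-wellFounded (p + q))
    where
      euclid : ∀ {L} p q → Acc _<_ (p + q) → HasPeriod w L p → HasPeriod w L q → 0 < p → 0 < q →
               p + q ≤ L → ∃ λ g → 0 < g × g ∣ p × g ∣ q × HasPeriod w L g
      euclid {L} p q _ per-p per-q 0<p 0<q p+q≤L with <-cmp p q
      ... | tri≈ _ refl _ = p , 0<p , ∣-refl , ∣-refl , per-p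
      euclid p q (acc rec) per-p per-q 0<p 0<q p+q≤L | tri< p<q _ _
        with m≤n⇒∃[o]m+o≡n (<⇒≤ p<q)
      ... | r , refl with euclid p r (rec (+-monoʳ-< p (m<n+m r 0<p))) per-p
                            (period-difference p r per-p per-q p+q≤L) 0<p 0<r
                            (≤-trans (m≤n+m (p + r) p) p+q≤L)
        where
          0<r : 0 < r
          0<r = +-cancelˡ-< p 0 r (subst (_< p + r) (sym (+-identityʳ p)) p<q)
      ...   | g , 0<g , g∣p , g∣r , per-g = g , 0<g , g∣p , ∣m∣n⇒∣m+n g∣p g∣r , per-g
      euclid {L} p q (acc rec) per-p per-q 0<p 0<q p+q≤L | tri> _ _ q<p
        with m≤n⇒∃[o]m+o≡n (<⇒≤ q<p)
      ... | r , refl with euclid q r (rec (m<m+n (q + r) 0<q)) per-q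
                            (period-difference q r per-q per-p (subst (_≤ L) (+-comm (q + r) q) p+q≤L)) 0<q 0<r
                            (≤-trans (m≤m+n (q + r) q) p+q≤L)
        where
          0<r : 0 < r
          0<r = +-cancelˡ-< q 0 r (subst (_< q + r) (sym (+-identityʳ q)) q<p)
      ...   | g , 0<g , g∣q , g∣r , per-g = g , 0<g , ∣m∣n⇒∣m+n g∣q g∣r , g∣q , per-g

common-divisor-≤-half : ∀ {g o Q} → g ∣ o → g ∣ Q → 0 < o → o < Q → g + g ≤ Q
common-divisor-≤-half {g} {o} {Q} g∣o g∣Q 0<o o<Q = begin
  g + g        ≤⟨ +-mono-≤ (∣⇒≤ {{>-nonZero 0<o}} g∣o) (∣⇒≤ {{>-nonZero (m<n⇒0<n∸m o<Q)}} g∣Q∸o) ⟩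
  o + (Q ∸ o)  ≡⟨ m+[n∸m]≡n (<⇒≤ o<Q) ⟩
  Q            ∎
  where
    open ≤-Reasoning
    g∣Q∸o : g ∣ Q ∸ o
    g∣Q∸o = ∣m+n∣m⇒∣n (subst (g ∣_) (sym (m+[n∸m]≡n (<⇒≤ o<Q))) g∣Q) g∣o

m+m≤n⇒m+2≤n : ∀ {m n} → 4 ≤ n → m + m ≤ n → m + 2 ≤ n
m+m≤n⇒m+2≤n {m} 4≤n m+m≤n with 2 ≤? m
... | yes 2≤m = ≤-trans (+-monoʳ-≤ m 2≤m) m+m≤n
... | no 2≰m  = ≤-trans (+-monoˡ-≤ 2 (≤-pred (≰⇒> 2≰m))) (≤-trans (n≤1+n 3) 4≤n)

-- Standard pairs

record StandardPair {A : Set} (u v : List A) : Set where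
  field
    central            : List A
    x y                : A
    x≢y                : x ≢ y
    uv≡central++xy     : u ++ v ≡ central ++ x ∷ y ∷ []
    vu≡central++yx     : v ++ u ≡ central ++ y ∷ x ∷ []
    central-palindrome : reverse central ≡ central
    u-conjugate        : u ++ central ≡ central ++ reverse u
    v-conjugate        : v ++ central ≡ central ++ reverse v

module _ {A : Set} where

  standardPair-base : {a b : A} → a ≢ b → ∀ t → StandardPair (replicate t a ++ b ∷ []) (a ∷ [])
  standardPair-base {a} {b} a≢b t = record
    { central            = aᵗ
    ; x                  = b
    ; y                  = a
    ; x≢y                = ≢-sym a≢b
    ; uv≡central++xy     = ++-assoc aᵗ (b ∷ []) (a ∷ [])
    ; vu≡central++yx     = trans (cong (_++ b ∷ []) (replicate-snoc t a)) (++-assoc aᵗ (a ∷ []) (b ∷ []))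
    ; central-palindrome = reverse-replicate t a
    ; u-conjugate        = begin
        (aᵗ ++ b ∷ []) ++ aᵗ         ≡⟨ ++-assoc aᵗ (b ∷ []) aᵗ ⟩
        aᵗ ++ b ∷ aᵗ                 ≡⟨ cong (λ z → aᵗ ++ b ∷ z) (reverse-replicate t a) ⟨
        aᵗ ++ b ∷ reverse aᵗ         ≡⟨ cong (aᵗ ++_) (reverse-++ aᵗ (b ∷ [])) ⟨
        aᵗ ++ reverse (aᵗ ++ b ∷ []) ∎
    ; v-conjugate        = replicate-snoc t a
    }
    where
      open ≡-Reasoning
      aᵗ : List A
      aᵗ = replicate t a

  module _ {u v : List A} (P : StandardPair u v) where
    open StandardPair P

    ^-central-conjugate : ∀ k → u ^ k ++ central ≡ central ++ reverse u ^ k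
    ^-central-conjugate = ^-conjugate u-conjugate

    ^-central-palindrome : ∀ k → reverse (u ^ k ++ central) ≡ u ^ k ++ central
    ^-central-palindrome k = begin
      reverse (u ^ k ++ central)              ≡⟨ reverse-++ (u ^ k) central ⟩
      reverse central ++ reverse (u ^ k)      ≡⟨ cong₂ _++_ central-palindrome (reverse-^ u k) ⟩
      central ++ reverse u ^ k                ≡⟨ ^-central-conjugate k ⟨
      u ^ k ++ central                        ∎
      where open ≡-Reasoning

    ^-central-≼ : ∀ j k → u ^ j ++ central ≼ u ^ (j + k) ++ central
    ^-central-≼ j k = reverse u ^ k , (begin
      u ^ (j + k) ++ central                     ≡⟨ ^-central-conjugate (j + k) ⟩
      central ++ reverse u ^ (j + k)             ≡⟨ cong (central ++_) (^-+ (reverse u) j k) ⟩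
      central ++ (reverse u ^ j ++ reverse u ^ k) ≡⟨ ++-assoc central _ _ ⟨
      (central ++ reverse u ^ j) ++ reverse u ^ k ≡⟨ cong (_++ reverse u ^ k) (^-central-conjugate j) ⟨
      (u ^ j ++ central) ++ reverse u ^ k         ∎)
      where open ≡-Reasoning

    module _ (t : ℕ) where
      private
        uᵗ : List A
        uᵗ = u ^ t

      step-uv : (uᵗ ++ v) ++ u ≡ (uᵗ ++ central) ++ y ∷ x ∷ []
      step-uv = begin
        (uᵗ ++ v) ++ u                 ≡⟨ ++-assoc uᵗ v u ⟩
        uᵗ ++ (v ++ u)                 ≡⟨ cong (uᵗ ++_) vu≡central++yx ⟩
        uᵗ ++ (central ++ y ∷ x ∷ [])  ≡⟨ ++-assoc uᵗ central _ ⟨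
        (uᵗ ++ central) ++ y ∷ x ∷ []  ∎
        where open ≡-Reasoning

      step-vu : u ++ (uᵗ ++ v) ≡ (uᵗ ++ central) ++ x ∷ y ∷ []
      step-vu = begin
        u ++ (uᵗ ++ v)                 ≡⟨ ++-assoc u uᵗ v ⟨
        (u ++ uᵗ) ++ v                 ≡⟨ cong (_++ v) (^-conjugate refl t) ⟨
        (uᵗ ++ u) ++ v                 ≡⟨ ++-assoc uᵗ u v ⟩
        uᵗ ++ (u ++ v)                 ≡⟨ cong (uᵗ ++_) uv≡central++xy ⟩
        uᵗ ++ (central ++ x ∷ y ∷ [])  ≡⟨ ++-assoc uᵗ central _ ⟨
        (uᵗ ++ central) ++ x ∷ y ∷ []  ∎
        where open ≡-Reasoning

      step-u-conjugate : (uᵗ ++ v) ++ (uᵗ ++ central) ≡ (uᵗ ++ central) ++ reverse (uᵗ ++ v)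
      step-u-conjugate = begin
        (uᵗ ++ v) ++ (uᵗ ++ central)                     ≡⟨ ++-assoc uᵗ v _ ⟩
        uᵗ ++ (v ++ (uᵗ ++ central))                     ≡⟨ cong (λ z → uᵗ ++ (v ++ z)) (^-central-conjugate t) ⟩
        uᵗ ++ (v ++ (central ++ reverse u ^ t))          ≡⟨ cong (uᵗ ++_) (++-assoc v central _) ⟨
        uᵗ ++ ((v ++ central) ++ reverse u ^ t)          ≡⟨ cong (λ z → uᵗ ++ (z ++ reverse u ^ t)) v-conjugate ⟩
        uᵗ ++ ((central ++ reverse v) ++ reverse u ^ t)  ≡⟨ cong (uᵗ ++_) (++-assoc central (reverse v) _) ⟩
        uᵗ ++ (central ++ (reverse v ++ reverse u ^ t))  ≡⟨ ++-assoc uᵗ central _ ⟨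
        (uᵗ ++ central) ++ (reverse v ++ reverse u ^ t)  ≡⟨ cong (λ z → (uᵗ ++ central) ++ (reverse v ++ z)) (reverse-^ u t) ⟨
        (uᵗ ++ central) ++ (reverse v ++ reverse uᵗ)     ≡⟨ cong ((uᵗ ++ central) ++_) (reverse-++ uᵗ v) ⟨
        (uᵗ ++ central) ++ reverse (uᵗ ++ v)             ∎
        where open ≡-Reasoning

      step-v-conjugate : u ++ (uᵗ ++ central) ≡ (uᵗ ++ central) ++ reverse u
      step-v-conjugate = begin
        u ++ (uᵗ ++ central)            ≡⟨ ++-assoc u uᵗ central ⟨
        (u ++ uᵗ) ++ central            ≡⟨ cong (_++ central) (^-conjugate refl t) ⟨
        (uᵗ ++ u) ++ central            ≡⟨ ++-assoc uᵗ u central ⟩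
        uᵗ ++ (u ++ central)            ≡⟨ cong (uᵗ ++_) u-conjugate ⟩
        uᵗ ++ (central ++ reverse u)    ≡⟨ ++-assoc uᵗ central _ ⟨
        (uᵗ ++ central) ++ reverse u    ∎
        where open ≡-Reasoning

  standardPair-step : {u v : List A} → StandardPair u v → ∀ t → StandardPair (u ^ t ++ v) u
  standardPair-step {u} P t = record
    { central            = u ^ t ++ central
    ; x                  = y
    ; y                  = x
    ; x≢y                = ≢-sym x≢y
    ; uv≡central++xy     = step-uv P t
    ; vu≡central++yx     = step-vu P t
    ; central-palindrome = ^-central-palindrome P t
    ; u-conjugate        = step-u-conjugate P t
    ; v-conjugate        = step-v-conjugate P t
    }
    where open StandardPair P

-- Arithmetic of ratios of consecutive lengths

-- b/a < ξ, where ξ = (3 + √13)/2 is the positive root of x² = 3x + 1.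
RatioBelowξ : ℕ → ℕ → Set
RatioBelowξ a b = b * b < a * a + 3 * (a * b)

-- (b − a)² ≤ 3a² + K, so that asymptotically b/a ≤ 1 + √3.
RatioBelow1+√3 : ℕ → ℕ → ℕ → Set
RatioBelow1+√3 K a b = b * b ≤ K + 2 * (a * b) + 2 * (a * a)

transition⇒ratio-below : ∀ u v ℓ a b → ℓ + 2 ≡ b + a → v * (ℓ + b) < u * ℓ →
                         v * (2 * b + a) < u * (b + a)
transition⇒ratio-below u v ℓ a b ℓ+2≡b+a v[ℓ+b]<uℓ with v ≤? u
... | no v≰u = ⊥-elim (<⇒≱ v[ℓ+b]<uℓ (≤-trans (*-monoˡ-≤ ℓ (<⇒≤ (≰⇒> v≰u))) (*-monoʳ-≤ v (m≤m+n ℓ b))))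
... | yes v≤u = begin-strict
  v * (2 * b + a)      ≡⟨ cong (v *_) 2b+a≡ℓ+b+2 ⟩
  v * (ℓ + b + 2)      ≡⟨ *-+2 v (ℓ + b) ⟩
  v * (ℓ + b) + 2 * v  <⟨ +-monoˡ-< (2 * v) v[ℓ+b]<uℓ ⟩
  u * ℓ + 2 * v        ≤⟨ +-monoʳ-≤ (u * ℓ) (*-monoʳ-≤ 2 v≤u) ⟩
  u * ℓ + 2 * u        ≡⟨ *-+2 u ℓ ⟨
  u * (ℓ + 2)          ≡⟨ cong (u *_) ℓ+2≡b+a ⟩
  u * (b + a)          ∎
  where
    open ≤-Reasoning
    *-+2 : ∀ x y → x * (y + 2) ≡ x * y + 2 * x
    *-+2 = solve-∀
    2b+a≡ℓ+b+2 : 2 * b + a ≡ ℓ + b + 2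
    2b+a≡ℓ+b+2 = trans (reorder₁ a b) (trans (cong (b +_) (sym ℓ+2≡b+a)) (reorder₂ b ℓ))
      where
        reorder₁ : ∀ a b → 2 * b + a ≡ b + (b + a)
        reorder₁ = solve-∀
        reorder₂ : ∀ b ℓ → b + (ℓ + 2) ≡ ℓ + b + 2
        reorder₂ = solve-∀

-- With 5β = α + γ, hypothesis and conclusion both say γ² < 39α² + 13αγ.
RatioBelowξ-from-γ : ∀ α β γ → α + γ ≡ 5 * β → γ * γ < 13 * ((α + β) * (α + β)) → RatioBelowξ α β
RatioBelowξ-from-γ α β γ α+γ≡5β γ²<13[α+β]² with β * β <? α * α + 3 * (α * β)
... | yes β²<α²+3αβ = β²<α²+3αβ
... | no  β²≮α²+3αβ = ⊥-elim (<-irrefl (trans lhs≡Φ (sym rhs≡Φ)) lhs<rhs)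
  where
    open ≡-Reasoning
    lhs<rhs : 300 * (α * α + 3 * (α * β)) + 25 * (γ * γ) < 300 * (β * β) + 25 * (13 * ((α + β) * (α + β)))
    lhs<rhs = +-mono-≤-< (*-monoʳ-≤ 300 (≮⇒≥ β²≮α²+3αβ)) (*-monoʳ-< 25 γ²<13[α+β]²)
    Φ : ℕ
    Φ = 480 * (α * α) + 180 * (α * γ) + 25 * (γ * γ)
    lhs≡Φ : 300 * (α * α + 3 * (α * β)) + 25 * (γ * γ) ≡ Φ
    lhs≡Φ = begin
      300 * (α * α + 3 * (α * β)) + 25 * (γ * γ)          ≡⟨ in-5β α β γ ⟩
      300 * (α * α) + 180 * (α * (5 * β)) + 25 * (γ * γ)   ≡⟨ cong (λ z → 300 * (α * α) + 180 * (α * z) + 25 * (γ * γ)) α+γ≡5β ⟨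
      300 * (α * α) + 180 * (α * (α + γ)) + 25 * (γ * γ)   ≡⟨ expand α γ ⟩
      Φ                                                    ∎
      where
        in-5β : ∀ α β γ → 300 * (α * α + 3 * (α * β)) + 25 * (γ * γ) ≡
                          300 * (α * α) + 180 * (α * (5 * β)) + 25 * (γ * γ)
        in-5β = solve-∀
        expand : ∀ α γ → 300 * (α * α) + 180 * (α * (α + γ)) + 25 * (γ * γ) ≡
                         480 * (α * α) + 180 * (α * γ) + 25 * (γ * γ)
        expand = solve-∀
    rhs≡Φ : 300 * (β * β) + 25 * (13 * ((α + β) * (α + β))) ≡ Φ
    rhs≡Φ = begin
      300 * (β * β) + 25 * (13 * ((α + β) * (α + β)))                              ≡⟨ in-5β α β ⟩
      12 * (5 * β * (5 * β)) + 13 * ((5 * α + 5 * β) * (5 * α + 5 * β))           ≡⟨ cong (λ z → 12 * (z * z) + 13 * ((5 * α + z) * (5 * α + z))) α+γ≡5β ⟨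
      12 * ((α + γ) * (α + γ)) + 13 * ((5 * α + (α + γ)) * (5 * α + (α + γ)))     ≡⟨ expand α γ ⟩
      Φ                                                                            ∎
      where
        in-5β : ∀ α β → 300 * (β * β) + 25 * (13 * ((α + β) * (α + β))) ≡
                        12 * (5 * β * (5 * β)) + 13 * ((5 * α + 5 * β) * (5 * α + 5 * β))
        in-5β = solve-∀
        expand : ∀ α γ → 12 * ((α + γ) * (α + γ)) + 13 * ((5 * α + (α + γ)) * (5 * α + (α + γ))) ≡
                         480 * (α * α) + 180 * (α * γ) + 25 * (γ * γ)
        expand = solve-∀

BelowC[α+2β,α+β]⇒RatioBelowξ : ∀ α β → BelowC (α + 2 * β) (α + β) → RatioBelowξ α β
BelowC[α+2β,α+β]⇒RatioBelowξ α β below with α ≤? 5 * β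
... | no α≰5β = ≤-trans (*-mono-< β<α β<α) (m≤m+n (α * α) _)
  where
    β<α : β < α
    β<α = ≤-<-trans (m≤m+n β (4 * β)) (≰⇒> α≰5β)
... | yes α≤5β = RatioBelowξ-from-γ α β γ α+γ≡5β (subst (λ z → z * z < 13 * ((α + β) * (α + β))) 6p∸7d≡γ below)
  where
    γ : ℕ
    γ = 5 * β ∸ α
    α+γ≡5β : α + γ ≡ 5 * β
    α+γ≡5β = m+[n∸m]≡n α≤5β
    6p+α≡7d+γ+α : 6 * (α + 2 * β) + α ≡ 7 * (α + β) + γ + α
    6p+α≡7d+γ+α = begin
      6 * (α + 2 * β) + α      ≡⟨ reorder₁ α β ⟩
      7 * (α + β) + 5 * β      ≡⟨ cong (7 * (α + β) +_) α+γ≡5β ⟨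
      7 * (α + β) + (α + γ)    ≡⟨ reorder₂ (7 * (α + β)) α γ ⟩
      7 * (α + β) + γ + α      ∎
      where
        open ≡-Reasoning
        reorder₁ : ∀ α β → 6 * (α + 2 * β) + α ≡ 7 * (α + β) + 5 * β
        reorder₁ = solve-∀
        reorder₂ : ∀ x α γ → x + (α + γ) ≡ x + γ + α
        reorder₂ = solve-∀
    6p∸7d≡γ : 6 * (α + 2 * β) ∸ 7 * (α + β) ≡ γ
    6p∸7d≡γ = trans (cong (_∸ 7 * (α + β)) (+-cancelʳ-≡ α _ _ 6p+α≡7d+γ+α)) (m+n∸m≡n (7 * (α + β)) γ)

RatioBelowξ-mono : ∀ {α β a b} → 0 < b → α * b ≤ β * a → RatioBelowξ α β → RatioBelowξ a b
RatioBelowξ-mono {α} {β} {a} {b} 0<b αb≤βa β²<α²+3αβ = *-cancelˡ-< (β * β) (b * b) _ (begin-strict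
  β * β * (b * b)                              ≡⟨ *-comm (β * β) (b * b) ⟩
  b * b * (β * β)                              <⟨ *-monoʳ-< (b * b) {{>-nonZero (*-mono-< 0<b 0<b)}} β²<α²+3αβ ⟩
  b * b * (α * α + 3 * (α * β))                ≡⟨ expand₁ α β b ⟩
  α * b * (α * b) + 3 * (α * b * (β * b))      ≤⟨ +-mono-≤ (*-mono-≤ αb≤βa αb≤βa) (*-monoʳ-≤ 3 (*-monoˡ-≤ (β * b) αb≤βa)) ⟩
  β * a * (β * a) + 3 * (β * a * (β * b))      ≡⟨ expand₂ β a b ⟩
  β * β * (a * a + 3 * (a * b))                ∎)
  where
    open ≤-Reasoning
    expand₁ : ∀ α β b → b * b * (α * α + 3 * (α * β)) ≡
                        α * b * (α * b) + 3 * (α * b * (β * b))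
    expand₁ = solve-∀
    expand₂ : ∀ β a b → β * a * (β * a) + 3 * (β * a * (β * b)) ≡ β * β * (a * a + 3 * (a * b))
    expand₂ = solve-∀

BelowC⇒u<2v : ∀ u v → BelowC u v → u < 2 * v
BelowC⇒u<2v u v below = ≰⇒> λ 2v≤u → <⇒≱ below (begin
  13 * (v * v)                        ≤⟨ *-monoˡ-≤ (v * v) (m≤m+n 13 12) ⟩
  25 * (v * v)                        ≡⟨ square-5 v ⟩
  5 * v * (5 * v)                     ≤⟨ *-mono-≤ (5v≤6u∸7v 2v≤u) (5v≤6u∸7v 2v≤u) ⟩
  (6 * u ∸ 7 * v) * (6 * u ∸ 7 * v)   ∎)
  where
    open ≤-Reasoning
    square-5 : ∀ v → 25 * (v * v) ≡ 5 * v * (5 * v)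
    square-5 = solve-∀
    6[2v]≡5v+7v : ∀ v → 6 * (2 * v) ≡ 5 * v + 7 * v
    6[2v]≡5v+7v = solve-∀
    5v≤6u∸7v : 2 * v ≤ u → 5 * v ≤ 6 * u ∸ 7 * v
    5v≤6u∸7v 2v≤u = m+n≤o⇒m≤o∸n (5 * v) (subst (_≤ 6 * u) (6[2v]≡5v+7v v) (*-monoʳ-≤ 6 2v≤u))

between⇒α+2β,α+β : ∀ {u v} → v ≤ u → u ≤ 2 * v → ∃ λ α → ∃ λ β → u ≡ α + 2 * β × v ≡ α + β
between⇒α+2β,α+β {u} {v} v≤u u≤2v = α , β , u≡α+2β , v≡α+β
  where
    open ≡-Reasoning
    α β : ℕ
    α = 2 * v ∸ u
    β = u ∸ v
    v+β≡u : v + β ≡ u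
    v+β≡u = m+[n∸m]≡n v≤u
    v≡α+β : v ≡ α + β
    v≡α+β = +-cancelˡ-≡ v v (α + β) (begin
      v + v        ≡⟨ cong (v +_) (+-identityʳ v) ⟨
      2 * v        ≡⟨ m+[n∸m]≡n u≤2v ⟨
      u + α        ≡⟨ cong (_+ α) v+β≡u ⟨
      v + β + α    ≡⟨ +-assoc v β α ⟩
      v + (β + α)  ≡⟨ cong (v +_) (+-comm β α) ⟩
      v + (α + β)  ∎)
    u≡α+2β : u ≡ α + 2 * β
    u≡α+2β = trans (sym v+β≡u) (trans (cong (_+ β) v≡α+β) (reorder α β))
      where
        reorder : ∀ α β → α + β + β ≡ α + 2 * β
        reorder = solve-∀

[α+β][2b+a]<[α+2β][b+a]⇒αb<βa : ∀ α β a b → (α + β) * (2 * b + a) < (α + 2 * β) * (b + a) → α * b < β * a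
[α+β][2b+a]<[α+2β][b+a]⇒αb<βa α β a b lt = +-cancelˡ-< common _ _ (subst₂ _<_ (left α β a b) (right α β a b) lt)
  where
    common : ℕ
    common = α * a + 2 * (β * b) + β * a + α * b
    left : ∀ α β a b → (α + β) * (2 * b + a) ≡ (α * a + 2 * (β * b) + β * a + α * b) + α * b
    left = solve-∀
    right : ∀ α β a b → (α + 2 * β) * (b + a) ≡ (α * a + 2 * (β * b) + β * a + α * b) + β * a
    right = solve-∀

-- With u = α + 2β and v = α + β, u/v = f(β/α) and v(2b + a) < u(b + a) says f(b/a) < f(β/α),
-- for the increasing map f(x) = (2x + 1)/(x + 1); moreover f(ξ) = (7 + √13)/6.
BelowC⇒RatioBelowξ : ∀ u v a b → BelowC u v → v * (2 * b + a) < u * (b + a) → 0 < b → RatioBelowξ a b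
BelowC⇒RatioBelowξ u v a b below v[2b+a]<u[b+a] 0<b with v ≤? u
... | no v≰u = ⊥-elim (<⇒≱ v[2b+a]<u[b+a] (*-mono-≤ (<⇒≤ (≰⇒> v≰u)) (+-monoˡ-≤ a (m≤n*m b 2))))
... | yes v≤u =
  let α , β , u≡α+2β , v≡α+β = between⇒α+2β,α+β v≤u (<⇒≤ (BelowC⇒u<2v u v below))
      αb<βa = [α+β][2b+a]<[α+2β][b+a]⇒αb<βa α β a b
                (subst₂ (λ u v → v * (2 * b + a) < u * (b + a)) u≡α+2β v≡α+β v[2b+a]<u[b+a])
  in RatioBelowξ-mono {α} {β} 0<b (<⇒≤ αb<βa) (BelowC[α+2β,α+β]⇒RatioBelowξ α β (subst₂ BelowC u≡α+2β v≡α+β below))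

RatioBelowξ-step⇒≤2 : ∀ t {a b} → RatioBelowξ a b → RatioBelowξ b (t * b + a) → t ≤ 2
RatioBelowξ-step⇒≤2 0 _ _ = z≤n
RatioBelowξ-step⇒≤2 1 _ _ = s≤s z≤n
RatioBelowξ-step⇒≤2 2 _ _ = s≤s (s≤s z≤n)
RatioBelowξ-step⇒≤2 3 {a} {b} r r′ = ⊥-elim (<-irrefl (sum≡ a b) (+-mono-< r′ r))
  where
    -- ξ = 3 + 1/ξ: the two bounds add up to an identity.
    sum≡ : ∀ a b → (3 * b + a) * (3 * b + a) + b * b ≡ b * b + 3 * (b * (3 * b + a)) + (a * a + 3 * (a * b))
    sum≡ = solve-∀
RatioBelowξ-step⇒≤2 t@(suc (suc (suc (suc _)))) {a} {b} _ r′ = ⊥-elim (<⇒≱ r′ (begin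
  b * b + 3 * (b * c)  ≤⟨ +-monoˡ-≤ (3 * (b * c)) (*-monoʳ-≤ b b≤c) ⟩
  b * c + 3 * (b * c)  ≡⟨ *-assoc 4 b c ⟨
  4 * b * c            ≤⟨ *-monoˡ-≤ c (≤-trans (*-monoˡ-≤ b 4≤t) (m≤m+n (t * b) a)) ⟩
  c * c                ∎))
  where
    open ≤-Reasoning
    c : ℕ
    c = t * b + a
    4≤t : 4 ≤ t
    4≤t = s≤s (s≤s (s≤s (s≤s z≤n)))
    b≤c : b ≤ c
    b≤c = ≤-trans (m≤n*m b t) (m≤m+n (t * b) a)

RatioBelow1+√3-after-1 : ∀ K a b → RatioBelow1+√3 K (b + a) (b + a + b)
RatioBelow1+√3-after-1 K a b = ≤-trans (m≤m+n _ slack) (≤-reflexive (identity K a b))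
  where
    slack : ℕ
    slack = K + 2 * (b * b) + 6 * (b * a) + 3 * (a * a)
    identity : ∀ K a b → (b + a + b) * (b + a + b) + (K + 2 * (b * b) + 6 * (b * a) + 3 * (a * a)) ≡
                         K + 2 * ((b + a) * (b + a + b)) + 2 * ((b + a) * (b + a))
    identity = solve-∀

RatioBelow1+√3-after-2,2 : ∀ K a b → RatioBelow1+√3 K (2 * b + a) (2 * (2 * b + a) + b)
RatioBelow1+√3-after-2,2 K a b = ≤-trans (m≤m+n _ slack) (≤-reflexive (identity K a b))
  where
    slack : ℕ
    slack = K + 3 * (b * b) + 6 * (b * a) + 2 * (a * a)
    identity : ∀ K a b → (2 * (2 * b + a) + b) * (2 * (2 * b + a) + b) + (K + 3 * (b * b) + 6 * (b * a) + 2 * (a * a)) ≡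
                         K + 2 * ((2 * b + a) * (2 * (2 * b + a) + b)) + 2 * ((2 * b + a) * (2 * b + a))
    identity = solve-∀

RatioBelow1+√3-after-1,2 : ∀ K a b → RatioBelow1+√3 K a b → RatioBelow1+√3 K (b + a) (2 * (b + a) + b)
RatioBelow1+√3-after-1,2 K a b bound = +-cancelʳ-≤ (2 * (a * b) + 2 * (a * a)) _ _ (begin
  b′ * b′ + (2 * (a * b) + 2 * (a * a))                              ≡⟨ identity₁ a b ⟩
  b * b + (2 * (a′ * b′) + 2 * (a′ * a′))                            ≤⟨ +-monoˡ-≤ _ bound ⟩
  K + 2 * (a * b) + 2 * (a * a) + (2 * (a′ * b′) + 2 * (a′ * a′))    ≡⟨ identity₂ K a b ⟩
  K + 2 * (a′ * b′) + 2 * (a′ * a′) + (2 * (a * b) + 2 * (a * a))    ∎)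
  where
    open ≤-Reasoning
    a′ b′ : ℕ
    a′ = b + a
    b′ = 2 * (b + a) + b
    identity₁ : ∀ a b → (2 * (b + a) + b) * (2 * (b + a) + b) + (2 * (a * b) + 2 * (a * a)) ≡
                        b * b + (2 * ((b + a) * (2 * (b + a) + b)) + 2 * ((b + a) * (b + a)))
    identity₁ = solve-∀
    identity₂ : ∀ K a b → K + 2 * (a * b) + 2 * (a * a) + (2 * ((b + a) * (2 * (b + a) + b)) + 2 * ((b + a) * (b + a))) ≡
                          K + 2 * ((b + a) * (2 * (b + a) + b)) + 2 * ((b + a) * (b + a)) + (2 * (a * b) + 2 * (a * a))
    identity₂ = solve-∀

-- A single step with partial quotient 2 may break the bound (e.g. from b = a); a pair of steps
-- with partial quotients in {1, 2} never does.
RatioBelow1+√3-twoSteps : ∀ K t₁ t₂ {a b} → 1 ≤ t₁ → t₁ ≤ 2 → 1 ≤ t₂ → t₂ ≤ 2 → RatioBelow1+√3 K a b →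
                          RatioBelow1+√3 K (t₁ * b + a) (t₂ * (t₁ * b + a) + b)
RatioBelow1+√3-twoSteps K 1 1 {a} {b} _ _ _ _ _ =
  subst₂ (RatioBelow1+√3 K) (sym (1*b+a≡b+a a b)) (sym (1*[1*b+a]+b≡ a b)) (RatioBelow1+√3-after-1 K a b)
  where
    1*b+a≡b+a : ∀ a b → 1 * b + a ≡ b + a
    1*b+a≡b+a = solve-∀
    1*[1*b+a]+b≡ : ∀ a b → 1 * (1 * b + a) + b ≡ b + a + b
    1*[1*b+a]+b≡ = solve-∀
RatioBelow1+√3-twoSteps K 2 1 {a} {b} _ _ _ _ _ =
  subst₂ (RatioBelow1+√3 K) (sym (2*b+a≡ a b)) (sym (1*[2*b+a]+b≡ a b)) (RatioBelow1+√3-after-1 K (b + a) b)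
  where
    2*b+a≡ : ∀ a b → 2 * b + a ≡ b + (b + a)
    2*b+a≡ = solve-∀
    1*[2*b+a]+b≡ : ∀ a b → 1 * (2 * b + a) + b ≡ b + (b + a) + b
    1*[2*b+a]+b≡ = solve-∀
RatioBelow1+√3-twoSteps K 1 2 {a} {b} _ _ _ _ bound =
  subst₂ (RatioBelow1+√3 K) (sym (1*b+a≡b+a a b)) (cong (λ z → 2 * z + b) (sym (1*b+a≡b+a a b)))
    (RatioBelow1+√3-after-1,2 K a b bound)
  where
    1*b+a≡b+a : ∀ a b → 1 * b + a ≡ b + a
    1*b+a≡b+a = solve-∀
RatioBelow1+√3-twoSteps K 2 2 {a} {b} _ _ _ _ _ = RatioBelow1+√3-after-2,2 K a b
RatioBelow1+√3-twoSteps K (suc (suc (suc _))) _ _ (s≤s (s≤s ())) _ _ _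
RatioBelow1+√3-twoSteps K 1 (suc (suc (suc _))) _ _ _ (s≤s (s≤s ())) _
RatioBelow1+√3-twoSteps K 2 (suc (suc (suc _))) _ _ _ (s≤s (s≤s ())) _

eventually-RatioBelow1+√3 : (a t : ℕ → ℕ) (M : ℕ) →
  (∀ m → M ≤ m → a (2 + m) ≡ t m * a (suc m) + a m) → (∀ m → M ≤ m → 1 ≤ t m × t m ≤ 2) →
  ∃ λ K → ∀ m → M ≤ m → RatioBelow1+√3 K (a m) (a (suc m))
eventually-RatioBelow1+√3 a t M a-rec t∈[1,2] = K , bound
  where
    K : ℕ
    K = a (suc M) * a (suc M) + a (2 + M) * a (2 + M)
    P : ℕ → Set
    P j = RatioBelow1+√3 K (a (j + M)) (a (suc (j + M)))
    twoSteps : ∀ j → P j → P (2 + j)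
    twoSteps j = subst₂ (RatioBelow1+√3 K) (sym a₂≡) (sym a₃≡)
      ∘ RatioBelow1+√3-twoSteps K (t m) (t (suc m)) (proj₁ t₁∈[1,2]) (proj₂ t₁∈[1,2]) (proj₁ t₂∈[1,2]) (proj₂ t₂∈[1,2])
      where
        m : ℕ
        m = j + M
        M≤m : M ≤ m
        M≤m = m≤n+m M j
        t₁∈[1,2] : 1 ≤ t m × t m ≤ 2
        t₁∈[1,2] = t∈[1,2] m M≤m
        t₂∈[1,2] : 1 ≤ t (suc m) × t (suc m) ≤ 2
        t₂∈[1,2] = t∈[1,2] (suc m) (m≤n⇒m≤1+n M≤m)
        a₂≡ : a (2 + m) ≡ t m * a (suc m) + a m
        a₂≡ = a-rec m M≤m
        a₃≡ : a (3 + m) ≡ t (suc m) * (t m * a (suc m) + a m) + a (suc m)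
        a₃≡ = trans (a-rec (suc m) (m≤n⇒m≤1+n M≤m)) (cong (λ z → t (suc m) * z + a (suc m)) a₂≡)
    consecutive : ∀ j → P j × P (suc j)
    consecutive zero    = ≤-trans (m≤m+n _ _) (≤-trans (m≤m+n K _) (m≤m+n _ _)) ,
                          ≤-trans (m≤n+m _ (a (suc M) * a (suc M))) (≤-trans (m≤m+n K _) (m≤m+n _ _))
    consecutive (suc j) = proj₂ (consecutive j) , twoSteps j (proj₁ (consecutive j))
    bound : ∀ m → M ≤ m → RatioBelow1+√3 K (a m) (a (suc m))
    bound m M≤m = subst (λ m → RatioBelow1+√3 K (a m) (a (suc m))) (m∸n+n≡m M≤m) (proj₁ (consecutive (m ∸ M)))

transition⇒ratio-above : ∀ d e y ℓ a b → ℓ ≤ y → ℓ + 2 ≡ b + a → (d + e) * y < d * (y + b) →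
                         e * (b + a) < d * b + 2 * e
transition⇒ratio-above d e y ℓ a b ℓ≤y ℓ+2≡b+a p*y<d*[y+b] = begin-strict
  e * (b + a)    ≡⟨ cong (e *_) ℓ+2≡b+a ⟨
  e * (ℓ + 2)    ≡⟨ *-distribˡ-+ e ℓ 2 ⟩
  e * ℓ + e * 2  ≤⟨ +-monoˡ-≤ (e * 2) (*-monoʳ-≤ e ℓ≤y) ⟩
  e * y + e * 2  <⟨ +-monoˡ-< (e * 2) ey<db ⟩
  d * b + e * 2  ≡⟨ cong (d * b +_) (*-comm e 2) ⟩
  d * b + 2 * e  ∎
  where
    open ≤-Reasoning
    ey<db : e * y < d * b
    ey<db = +-cancelˡ-< (d * y) _ _ (subst₂ _<_ (*-distribʳ-+ y d e) (*-distribˡ-+ d y b) p*y<d*[y+b])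

square≤linear⇒≤ : ∀ b X Y → b * b ≤ X * b + Y → b ≤ X + Y
square≤linear⇒≤ b X Y b²≤Xb+Y = ≮⇒≥ λ X+Y<b → <⇒≱ (begin-strict
  X * b + Y      ≤⟨ +-monoʳ-≤ (X * b) (m≤m*n Y b {{>-nonZero (≤-<-trans z≤n X+Y<b)}}) ⟩
  X * b + Y * b  ≡⟨ *-distribʳ-+ b X Y ⟨
  (X + Y) * b    <⟨ *-monoˡ-< b {{>-nonZero (≤-<-trans z≤n X+Y<b)}} X+Y<b ⟩
  b * b          ∎) b²≤Xb+Y
  where open ≤-Reasoning

3d²<p²⇒slack : ∀ e f → 3 * ((e + f) * (e + f)) < (e + f + e) * (e + f + e) → 2 * (e * f) + 2 * (f * f) < e * e
3d²<p²⇒slack e f 3d²<p² = +-cancelˡ-< (3 * (e * e) + 4 * (e * f) + f * f) _ _ (subst₂ _<_ (lhs e f) (rhs e f) 3d²<p²)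
  where
    lhs : ∀ e f → 3 * ((e + f) * (e + f)) ≡ 3 * (e * e) + 4 * (e * f) + f * f + (2 * (e * f) + 2 * (f * f))
    lhs = solve-∀
    rhs : ∀ e f → (e + f + e) * (e + f + e) ≡ 3 * (e * e) + 4 * (e * f) + f * f + e * e
    rhs = solve-∀

RatioBelow1+√3⇒bounded : ∀ K a b e f → 2 * (e * f) + 2 * (f * f) < e * e → e * a ≤ f * b + 2 * e →
                         RatioBelow1+√3 K a b → b ≤ (K + 20) * ((e + f) * (e + f))
RatioBelow1+√3⇒bounded K a b e f slack ea≤fb+2e bound = begin
  b             ≤⟨ square≤linear⇒≤ b X Y b²≤Xb+Y ⟩
  X + Y         ≤⟨ m≤m+n (X + Y) rest ⟩
  X + Y + rest  ≡⟨ expand K e f ⟩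
  (K + 20) * ((e + f) * (e + f))  ∎
  where
    open ≤-Reasoning
    X Y rest c z : ℕ
    X = 4 * (e * e) + 8 * (e * f)
    Y = e * e * K + 8 * (e * e)
    rest = 2 * (K * (e * f)) + K * (f * f) + 8 * (e * e) + 32 * (e * f) + 20 * (f * f)
    c = 2 * (e * f) + 2 * (f * f)
    z = f * b + 2 * e
    b²≤Xb+Y : b * b ≤ X * b + Y
    b²≤Xb+Y = +-cancelˡ-≤ (c * (b * b)) _ _ (begin
      c * (b * b) + b * b                                    ≡⟨ +-comm (c * (b * b)) (b * b) ⟩
      suc c * (b * b)                                        ≤⟨ *-monoˡ-≤ (b * b) slack ⟩
      e * e * (b * b)                                        ≤⟨ *-monoʳ-≤ (e * e) bound ⟩
      e * e * (K + 2 * (a * b) + 2 * (a * a))                ≡⟨ in-ea,eb e K a b ⟩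
      e * e * K + 2 * (e * a * (e * b)) + 2 * (e * a * (e * a))
        ≤⟨ +-mono-≤ (+-monoʳ-≤ (e * e * K) (*-monoʳ-≤ 2 (*-monoˡ-≤ (e * b) ea≤fb+2e))) (*-monoʳ-≤ 2 (*-mono-≤ ea≤fb+2e ea≤fb+2e)) ⟩
      e * e * K + 2 * (z * (e * b)) + 2 * (z * z)            ≡⟨ collect e f K b ⟩
      c * (b * b) + (X * b + Y)                              ∎)
      where
        in-ea,eb : ∀ e K a b → e * e * (K + 2 * (a * b) + 2 * (a * a)) ≡
                               e * e * K + 2 * (e * a * (e * b)) + 2 * (e * a * (e * a))
        in-ea,eb = solve-∀
        collect : ∀ e f K b → e * e * K + 2 * ((f * b + 2 * e) * (e * b)) + 2 * ((f * b + 2 * e) * (f * b + 2 * e)) ≡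
                  (2 * (e * f) + 2 * (f * f)) * (b * b) + ((4 * (e * e) + 8 * (e * f)) * b + (e * e * K + 8 * (e * e)))
        collect = solve-∀
    expand : ∀ K e f → 4 * (e * e) + 8 * (e * f) + (e * e * K + 8 * (e * e)) +
                       (2 * (K * (e * f)) + K * (f * f) + 8 * (e * e) + 32 * (e * f) + 20 * (f * f)) ≡
                       (K + 20) * ((e + f) * (e + f))
    expand = solve-∀

ratio-above-√3⇒bounded : ∀ K a b d e → 3 * (d * d) < (d + e) * (d + e) → 2 ≤ a →
  RatioBelow1+√3 K a b → e * (b + a) < d * b + 2 * e → b ≤ (K + 20) * (d * d)
ratio-above-√3⇒bounded K a b d e 3d²<p² 2≤a bound above with d ≤? e
... | yes d≤e = ⊥-elim (<⇒≱ above (begin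
  d * b + 2 * e  ≤⟨ +-mono-≤ (*-monoˡ-≤ b d≤e) (≤-reflexive (*-comm 2 e)) ⟩
  e * b + e * 2  ≤⟨ +-monoʳ-≤ (e * b) (*-monoʳ-≤ e 2≤a) ⟩
  e * b + e * a  ≡⟨ *-distribˡ-+ e b a ⟨
  e * (b + a)    ∎))
  where open ≤-Reasoning
... | no d≰e = subst (λ d → b ≤ (K + 20) * (d * d)) e+f≡d (RatioBelow1+√3⇒bounded K a b e f slack ea≤fb+2e bound)
  where
    f : ℕ
    f = d ∸ e
    e+f≡d : e + f ≡ d
    e+f≡d = m+[n∸m]≡n (<⇒≤ (≰⇒> d≰e))
    slack : 2 * (e * f) + 2 * (f * f) < e * e
    slack = 3d²<p²⇒slack e f (subst (λ d → 3 * (d * d) < (d + e) * (d + e)) (sym e+f≡d) 3d²<p²)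
    ea≤fb+2e : e * a ≤ f * b + 2 * e
    ea≤fb+2e = <⇒≤ (+-cancelˡ-< (e * b) _ _ (subst₂ _<_ (*-distribˡ-+ e b a) (split e f b)
                 (subst (λ d → e * (b + a) < d * b + 2 * e) (sym e+f≡d) above)))
      where
        split : ∀ e f b → (e + f) * b + 2 * e ≡ e * b + (f * b + 2 * e)
        split = solve-∀

-- Characteristic Sturmian words

module CharacteristicSturmian (s : ℕ → ℕ) (s-pos : ∀ k → 0 < s (suc k)) where

  σ-pair : ∀ m → StandardPair (σ s (suc m)) (σ s m)
  σ-pair zero    = standardPair-base (λ ()) (s 1 ∸ 1)
  σ-pair (suc m) = standardPair-step (σ-pair m) (s (2 + m))

  c : ℕ → List Bool
  c m = StandardPair.central (σ-pair m)

  -- Opaque, so that q and ℓ at numeral levels do not unfold σ when types are compared.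
  opaque
    q : ℕ → ℕ
    q m = length (σ s m)

    ℓ : ℕ → ℕ
    ℓ m = length (c m)

    length-c : ∀ m → length (c m) ≡ ℓ m
    length-c m = refl

    length-σ^k++c : ∀ m k → length (σ s (suc m) ^ k ++ c m) ≡ k * q (suc m) + ℓ m
    length-σ^k++c m k = trans (length-++ (σ s (suc m) ^ k)) (cong (_+ ℓ m) (length-^ (σ s (suc m)) k))

    q-0 : q 0 ≡ 1
    q-0 = refl

    q-1 : q 1 ≡ s 1
    q-1 = trans (length-++ (replicate (s 1 ∸ 1) false))
                (trans (cong (_+ 1) (length-replicate (s 1 ∸ 1))) (m∸n+n≡m (s-pos 0)))

    q-rec : ∀ m → q (2 + m) ≡ s (2 + m) * q (suc m) + q m
    q-rec m = trans (length-++ (σ s (suc m) ^ s (2 + m))) (cong (_+ q m) (length-^ (σ s (suc m)) (s (2 + m))))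

    ℓ-rec : ∀ m → ℓ (suc m) ≡ s (2 + m) * q (suc m) + ℓ m
    ℓ-rec m = length-σ^k++c m (s (2 + m))

    ℓ+2≡q+q : ∀ m → ℓ m + 2 ≡ q (suc m) + q m
    ℓ+2≡q+q m = begin
      ℓ m + 2                        ≡⟨ length-++ (c m) ⟨
      length (c m ++ x ∷ y ∷ [])     ≡⟨ cong length uv≡central++xy ⟨
      length (σ s (suc m) ++ σ s m)  ≡⟨ length-++ (σ s (suc m)) ⟩
      q (suc m) + q m                ∎
      where
        open ≡-Reasoning
        open StandardPair (σ-pair m)

  q≤sq : ∀ m → q (suc m) ≤ s (2 + m) * q (suc m)
  q≤sq m = m≤n*m (q (suc m)) (s (2 + m)) {{>-nonZero (s-pos (suc m))}}

  q-step : ∀ m → q (suc m) + q m ≤ q (2 + m)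
  q-step m = subst (q (suc m) + q m ≤_) (sym (q-rec m)) (+-monoˡ-≤ (q m) (q≤sq m))

  q-pos : ∀ m → 0 < q m
  q-pos zero          = subst (0 <_) (sym q-0) z<s
  q-pos (suc zero)    = subst (0 <_) (sym q-1) (s-pos 0)
  q-pos (suc (suc m)) = <-≤-trans (q-pos m) (≤-trans (m≤n+m (q m) (q (suc m))) (q-step m))

  m≤q[m] : ∀ m → m ≤ q m
  m≤q[m] zero          = z≤n
  m≤q[m] (suc zero)    = q-pos 1
  m≤q[m] (suc (suc m)) =
    ≤-trans (subst (_≤ q (suc m) + q m) (+-comm (suc m) 1) (+-mono-≤ (m≤q[m] (suc m)) (q-pos m))) (q-step m)

  q-coprime : ∀ m → Coprime (q (suc m)) (q m)
  q-coprime zero    (_ , d∣q₀)          = ∣1⇒≡1 (subst (_ ∣_) q-0 d∣q₀)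
  q-coprime (suc m) (d∣q[2+m] , d∣q[1+m]) =
    q-coprime m (d∣q[1+m] , ∣m+n∣m⇒∣n (subst (_ ∣_) (q-rec m) d∣q[2+m]) (∣n⇒∣m*n (s (2 + m)) d∣q[1+m]))

  -- π m k = |σ_{m+1}^k c_m|; for m ≥ 3 these are all the palindromic prefix lengths of w
  -- between ℓ m and ℓ (m + 1).
  π : ℕ → ℕ → ℕ
  π m k = k * q (suc m) + ℓ m

  π-suc : ∀ m k → π m (suc k) ≡ π m k + q (suc m)
  π-suc m k = trans (+-assoc (q (suc m)) (k * q (suc m)) (ℓ m)) (+-comm (q (suc m)) (π m k))

  π-< : ∀ m k → π m k < π m (suc k)
  π-< m k = subst (π m k <_) (sym (π-suc m k)) (m<m+n (π m k) (q-pos (suc m)))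

  σ-grows : ∀ m → σ s (suc m) ≼ σ s (2 + m)
  σ-grows m with s (2 + m) | s-pos (suc m)
  ... | suc t | _ = σ s (suc m) ^ t ++ σ s m , ++-assoc (σ s (suc m)) (σ s (suc m) ^ t) (σ s m)

  σσ≼σ : ∀ m → σ s (2 + m) ++ σ s (suc m) ≼ σ s (3 + m)
  σσ≼σ m with s (3 + m) | s-pos (2 + m)
  ... | suc t | _ with σ-suc≼ t
    where
      σ-suc≼ : ∀ t → σ s (suc m) ≼ σ s (2 + m) ^ t ++ σ s (suc m)
      σ-suc≼ zero    = [] , sym (++-identityʳ (σ s (suc m)))
      σ-suc≼ (suc t) = ≼-trans (σ-grows m) (σ s (2 + m) ^ t ++ σ s (suc m) , ++-assoc (σ s (2 + m)) _ _)
  ...   | R , eq = R , (begin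
    (σ s (2 + m) ++ σ s (2 + m) ^ t) ++ σ s (suc m)  ≡⟨ ++-assoc (σ s (2 + m)) _ _ ⟩
    σ s (2 + m) ++ (σ s (2 + m) ^ t ++ σ s (suc m))  ≡⟨ cong (σ s (2 + m) ++_) eq ⟩
    σ s (2 + m) ++ (σ s (suc m) ++ R)                ≡⟨ ++-assoc (σ s (2 + m)) (σ s (suc m)) R ⟨
    (σ s (2 + m) ++ σ s (suc m)) ++ R                ∎)
    where open ≡-Reasoning

  central≼σσ : ∀ m → c (suc m) ≼ σ s (2 + m) ++ σ s (suc m)
  central≼σσ m = _ , StandardPair.uv≡central++xy (σ-pair (suc m))

  σ^k++c≼central : ∀ m {k} → k ≤ s (2 + m) → σ s (suc m) ^ k ++ c m ≼ c (suc m)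
  σ^k++c≼central m {k} k≤s with m≤n⇒∃[o]m+o≡n k≤s
  ... | j , k+j≡s = subst (λ t → σ s (suc m) ^ k ++ c m ≼ σ s (suc m) ^ t ++ c m) k+j≡s
                          (^-central-≼ (σ-pair m) k j)

  ℓ[1+m]+1<ℓ[2+m] : ∀ m → ℓ (suc m) + 1 < ℓ (2 + m)
  ℓ[1+m]+1<ℓ[2+m] m = begin-strict
    ℓ (suc m) + 1                   <⟨ +-monoʳ-< (ℓ (suc m)) (n<1+n 1) ⟩
    ℓ (suc m) + 2                   ≡⟨ +-comm (ℓ (suc m)) 2 ⟩
    2 + ℓ (suc m)                   ≤⟨ +-monoˡ-≤ (ℓ (suc m)) (≤-trans (m≤m+n 2 m) (m≤q[m] (2 + m))) ⟩
    q (2 + m) + ℓ (suc m)           ≤⟨ +-monoˡ-≤ (ℓ (suc m)) (q≤sq (suc m)) ⟩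
    s (3 + m) * q (2 + m) + ℓ (suc m)  ≡⟨ ℓ-rec (suc m) ⟨
    ℓ (2 + m)                       ∎
    where open ≤-Reasoning

  m≤ℓ[m] : ∀ m → m ≤ ℓ m
  m≤ℓ[m] m = +-cancelʳ-≤ 2 m (ℓ m) (begin
    m + 2            ≡⟨ +-suc m 1 ⟩
    suc m + 1        ≤⟨ +-mono-≤ (m≤q[m] (suc m)) (q-pos m) ⟩
    q (suc m) + q m  ≡⟨ ℓ+2≡q+q m ⟨
    ℓ m + 2          ∎)
    where open ≤-Reasoning

  ℓ-mono : ∀ {m m′} → m ≤ m′ → ℓ m ≤ ℓ m′
  ℓ-mono = stepwise-mono-≤ ℓ (λ m → subst (ℓ m ≤_) (sym (ℓ-rec m)) (m≤n+m (ℓ m) _))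

  π≤ℓ : ∀ m {k} → k < s (2 + m) → π m (suc k) ≤ ℓ (suc m)
  π≤ℓ m {k} k<s = subst (π m (suc k) ≤_) (sym (ℓ-rec m)) (+-monoˡ-≤ (ℓ m) (*-monoˡ-≤ (q (suc m)) k<s))

  RatioBelowξ⇒s≤2 : ∀ {M} → (∀ m → M ≤ m → RatioBelowξ (q m) (q (suc m))) → ∀ m → M ≤ m → s (2 + m) ≤ 2
  RatioBelowξ⇒s≤2 ratio m M≤m = RatioBelowξ-step⇒≤2 (s (2 + m)) (ratio m M≤m)
    (subst (RatioBelowξ (q (suc m))) (q-rec m) (ratio (suc m) (m≤n⇒m≤1+n M≤m)))

  s≤2⇒RatioBelow1+√3 : ∀ {M} → (∀ m → M ≤ m → s (2 + m) ≤ 2) →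
                       ∃ λ K → ∀ m → M ≤ m → RatioBelow1+√3 K (q m) (q (suc m))
  s≤2⇒RatioBelow1+√3 {M} s≤2 =
    eventually-RatioBelow1+√3 q (λ m → s (2 + m)) M (λ m _ → q-rec m) (λ m M≤m → s-pos (suc m) , s≤2 m M≤m)

  module Limit {w : ℕ → Bool} (w-lim : IsCharSturmian s w) where

    σ⊑w : ∀ m → σ s (suc m) ⊑ w
    σ⊑w = ⊑-limit (λ m → σ s (suc m)) σ-grows
            (λ k → map₂ (λ σ‼k m N≤m → σ‼k (suc m) (m≤n⇒m≤1+n N≤m)) (w-lim k))

    σσ⊑w : ∀ m → σ s (2 + m) ++ σ s (suc m) ⊑ w
    σσ⊑w m = ≼-⊑ (σσ≼σ m) (σ⊑w (2 + m))

    π-pal : ∀ m k → k ≤ s (2 + m) → PalPrefix w (π m k)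
    π-pal m k k≤s = subst (PalPrefix w) (length-σ^k++c m k)
      (palindrome⇒PalPrefix (σ s (suc m) ^ k ++ c m) (^-central-palindrome (σ-pair m) k)
        (≼-⊑ (σ^k++c≼central m k≤s) (≼-⊑ (central≼σσ m) (σσ⊑w m))))

    w[ℓ]≢w[ℓ+1] : ∀ m → w (ℓ (suc m)) ≢ w (ℓ (suc m) + 1)
    w[ℓ]≢w[ℓ+1] m w[ℓ]≡w[ℓ+1] = x≢y (begin
      x                  ≡⟨ just-injective (⊑-letter (c (suc m)) (x ∷ y ∷ []) cxy⊑w z<s) ⟩
      w (length (c (suc m)) + 0)  ≡⟨ cong w (trans (+-identityʳ _) (length-c (suc m))) ⟩
      w (ℓ (suc m))      ≡⟨ w[ℓ]≡w[ℓ+1] ⟩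
      w (ℓ (suc m) + 1)  ≡⟨ cong (λ z → w (z + 1)) (length-c (suc m)) ⟨
      w (length (c (suc m)) + 1)  ≡⟨ just-injective (⊑-letter (c (suc m)) (x ∷ y ∷ []) cxy⊑w (s≤s z<s)) ⟨
      y                  ∎)
      where
        open StandardPair (σ-pair (suc m))
        open ≡-Reasoning
        cxy⊑w : c (suc m) ++ x ∷ y ∷ [] ⊑ w
        cxy⊑w = subst (_⊑ w) uv≡central++xy (σσ⊑w m)

    period-q : ∀ m k → k < s (2 + m) → HasPeriod w (π m (suc k)) (q (suc m))
    period-q m k k<s = subst (λ L → HasPeriod w L (q (suc m))) (sym (π-suc m k))
      (palPrefixes⇒period w (π m k) (q (suc m)) (π-pal m k (<⇒≤ k<s))
        (subst (PalPrefix w) (π-suc m k) (π-pal m (suc k) k<s)))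

    period-ℓ : ∀ m → HasPeriod w (ℓ (suc m)) (q (suc m))
    period-ℓ m = subst (λ L → HasPeriod w L (q (suc m))) π[1+pred[t]]≡ℓ
      (period-q m (pred t) (subst (pred t <_) (suc-pred t) (n<1+n (pred t))))
      where
        t : ℕ
        t = s (2 + m)
        instance
          _ : NonZero t
          _ = >-nonZero (s-pos (suc m))
        π[1+pred[t]]≡ℓ : π m (suc (pred t)) ≡ ℓ (suc m)
        π[1+pred[t]]≡ℓ = trans (cong (π m) (suc-pred t)) (sym (ℓ-rec m))

    no-small-period : ∀ m {g} → 0 < g → g ∣ q (3 + m) → g + 2 ≤ q (3 + m) →
                      ¬ HasPeriod w (ℓ (2 + m)) g
    no-small-period m {g} 0<g g∣q g+2≤q per-g =
      common-period⇒⊥ (fine-wilf w g (q (2 + m)) per-g (period-ℓ (suc m)) 0<g (q-pos (2 + m)) g+q≤ℓ)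
      where
        g+q≤ℓ : g + q (2 + m) ≤ ℓ (2 + m)
        g+q≤ℓ = +-cancelʳ-≤ 2 _ _ (begin
          g + q (2 + m) + 2      ≡⟨ +-assoc g (q (2 + m)) 2 ⟩
          g + (q (2 + m) + 2)    ≡⟨ cong (g +_) (+-comm (q (2 + m)) 2) ⟩
          g + (2 + q (2 + m))    ≡⟨ +-assoc g 2 (q (2 + m)) ⟨
          g + 2 + q (2 + m)      ≤⟨ +-monoˡ-≤ (q (2 + m)) g+2≤q ⟩
          q (3 + m) + q (2 + m)  ≡⟨ ℓ+2≡q+q (2 + m) ⟨
          ℓ (2 + m) + 2          ∎)
          where open ≤-Reasoning
        common-period⇒⊥ : (∃ λ h → 0 < h × h ∣ g × h ∣ q (2 + m) × HasPeriod w (ℓ (2 + m)) h) → ⊥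
        common-period⇒⊥ (h , _ , h∣g , h∣q[2+m] , per-h) =
          w[ℓ]≢w[ℓ+1] m (per-1 (ℓ (suc m)) (ℓ[1+m]+1<ℓ[2+m] m))
          where
            per-1 : HasPeriod w (ℓ (2 + m)) 1
            per-1 = subst (HasPeriod w (ℓ (2 + m))) (q-coprime (2 + m) (∣-trans h∣g g∣q , h∣q[2+m])) per-h

    gap-free : ∀ m {k x} → 3 ≤ m → k < s (2 + m) → π m k < x → x < π m (suc k) → ¬ PalPrefix w x
    gap-free m {k} {x} (s≤s (s≤s (s≤s {n = j} _))) k<s y<x x<y′ pal-x =
      common-period⇒⊥ (fine-wilf w o Q per-o per-Q 0<o (q-pos (suc m)) o+Q≤x)
      where
        y Q o : ℕ
        y = π m k
        Q = q (suc m)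
        o = x ∸ y
        y+o≡x : y + o ≡ x
        y+o≡x = m+[n∸m]≡n (<⇒≤ y<x)
        0<o : 0 < o
        0<o = m<n⇒0<n∸m y<x
        o<Q : o < Q
        o<Q = +-cancelˡ-< y o Q (subst₂ _<_ (sym y+o≡x) (π-suc m k) x<y′)
        per-o : HasPeriod w x o
        per-o = subst (λ L → HasPeriod w L o) y+o≡x
          (palPrefixes⇒period w y o (π-pal m k (<⇒≤ k<s)) (subst (PalPrefix w) (sym y+o≡x) pal-x))
        per-Q : HasPeriod w x Q
        per-Q = HasPeriod-≤ w (<⇒≤ x<y′) (period-q m k k<s)
        ℓ≤y : ℓ m ≤ y
        ℓ≤y = m≤n+m (ℓ m) (k * Q)
        Q≤ℓ : Q ≤ ℓ m
        Q≤ℓ = +-cancelʳ-≤ 2 Q (ℓ m)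
          (≤-trans (+-monoʳ-≤ Q (≤-trans (s≤s (s≤s z≤n)) (m≤q[m] m))) (≤-reflexive (sym (ℓ+2≡q+q m))))
        o+Q≤x : o + Q ≤ x
        o+Q≤x = ≤-trans (+-monoʳ-≤ o (≤-trans Q≤ℓ ℓ≤y)) (≤-reflexive (trans (+-comm o y) y+o≡x))
        common-period⇒⊥ : (∃ λ g → 0 < g × g ∣ o × g ∣ Q × HasPeriod w x g) → ⊥
        common-period⇒⊥ (g , 0<g , g∣o , g∣Q , per-g) =
          no-small-period (suc j) 0<g g∣Q g+2≤Q (HasPeriod-≤ w (≤-trans ℓ≤y (<⇒≤ y<x)) per-g)
          where
            g+2≤Q : g + 2 ≤ Q
            g+2≤Q = m+m≤n⇒m+2≤n (≤-trans (m≤m+n 4 j) (m≤q[m] (suc m))) (common-divisor-≤-half g∣o g∣Q 0<o o<Q)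

    module Enumeration {n : ℕ → ℕ} (E : IsPalPrefixLengths w n) where
      open PalPrefixLengths E

      n-next-π : ∀ {i m k} → 3 ≤ m → k < s (2 + m) → n i ≡ π m k → n (suc i) ≡ π m (suc k)
      n-next-π {i} {m} {k} 3≤m k<s ni≡π = ≤-antisym
        (n-next-≤ i _ (π-pal m (suc k) k<s) (subst (_< π m (suc k)) (sym ni≡π) (π-< m k)))
        (≮⇒≥ (λ n[1+i]<π → gap-free m 3≤m k<s (subst (_< n (suc i)) ni≡π (n-step i)) n[1+i]<π (n-pal (suc i))))

      OnGrid : ℕ → Set
      OnGrid i = ∃ λ m → ∃ λ k → 3 ≤ m × k < s (2 + m) × n i ≡ π m k

      onGrid-next : ∀ {i} → OnGrid i → OnGrid (suc i)
      onGrid-next (m , k , 3≤m , k<s , ni≡π) with m≤n⇒m<n∨m≡n k<s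
      ... | inj₁ 1+k<s = m , suc k , 3≤m , 1+k<s , n-next-π 3≤m k<s ni≡π
      ... | inj₂ 1+k≡s = suc m , 0 , m≤n⇒m≤1+n 3≤m , s-pos (2 + m) ,
            trans (n-next-π 3≤m k<s ni≡π) (trans (cong (π m) 1+k≡s) (sym (ℓ-rec m)))

      gridStart : ∃ λ i₀ → n i₀ ≡ ℓ 3
      gridStart = n-complete (ℓ 3) (π-pal 3 0 z≤n)

      i₀ : ℕ
      i₀ = proj₁ gridStart

      onGrid-+ : ∀ j → OnGrid (j + i₀)
      onGrid-+ zero    = 3 , 0 , ≤-refl , s-pos 4 , proj₂ gridStart
      onGrid-+ (suc j) = onGrid-next (onGrid-+ j)

      onGrid : ∀ i → i₀ ≤ i → OnGrid i
      onGrid i i₀≤i = subst OnGrid (trans (+-comm (i ∸ i₀) i₀) (m+[n∸m]≡n i₀≤i)) (onGrid-+ (i ∸ i₀))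

      GridStep : ℕ → ℕ → Set
      GridStep M i = ∃ λ m → ∃ λ k → M ≤ m × 3 ≤ m × n i ≡ π m k × n (suc i) ≡ π m (suc k)

      gridStep : ∀ M i → i₀ + ℓ M ≤ i → OnGrid i → GridStep M i
      gridStep M i N≤i (m , k , 3≤m , k<s , ni≡π) = m , k , M≤m , 3≤m , ni≡π , n-next-π 3≤m k<s ni≡π
        where
          M≤m : M ≤ m
          M≤m = ≮⇒≥ λ m<M → <⇒≱ (begin-strict
            n i            ≡⟨ ni≡π ⟩
            π m k          <⟨ π-< m k ⟩
            π m (suc k)    ≤⟨ π≤ℓ m k<s ⟩
            ℓ (suc m)      ≤⟨ ℓ-mono m<M ⟩
            ℓ M            ≤⟨ m≤n+m (ℓ M) i₀ ⟩
            i₀ + ℓ M       ≤⟨ N≤i ⟩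
            i              ≤⟨ i≤n[i] i ⟩
            n i            ∎) ≤-refl
            where open ≤-Reasoning

      eventually-gridStep : ∀ M i → i₀ + ℓ M ≤ i → GridStep M i
      eventually-gridStep M i N≤i = gridStep M i N≤i (onGrid i (≤-trans (m≤m+n i₀ (ℓ M)) N≤i))

      ℓ-transition : ∀ m → 3 ≤ m → ∃ λ i → n i ≡ ℓ m × n (suc i) ≡ π m 1
      ℓ-transition m 3≤m with n-complete (ℓ m) (π-pal m 0 z≤n)
      ... | i , ni≡ℓ = i , ni≡ℓ , n-next-π 3≤m (s-pos (suc m)) ni≡ℓ

      below⇒RatioBelowξ : DeltaBelowC n → ∃ λ M → ∀ m → M ≤ m → RatioBelowξ (q m) (q (suc m))
      below⇒RatioBelowξ (u , v , _ , below , N , eventually-below) = 3 + n N , ratio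
        where
          ratio : ∀ m → 3 + n N ≤ m → RatioBelowξ (q m) (q (suc m))
          ratio m 3+nN≤m = at (ℓ-transition m (≤-trans (m≤m+n 3 (n N)) 3+nN≤m))
            where
              at : (∃ λ i → n i ≡ ℓ m × n (suc i) ≡ π m 1) → RatioBelowξ (q m) (q (suc m))
              at (i , ni≡ℓ , n[1+i]≡π) = BelowC⇒RatioBelowξ u v (q m) (q (suc m)) below
                (transition⇒ratio-below u v (ℓ m) (q m) (q (suc m)) (ℓ+2≡q+q m)
                  (subst₂ (λ x y → v * x < u * y) (trans n[1+i]≡π (π-suc m 0)) ni≡ℓ (eventually-below i N≤i)))
                (q-pos (suc m))
                where
                  N≤i : N ≤ i
                  N≤i = n-cancel-≤ (begin
                    n N    ≤⟨ m≤n+m (n N) 3 ⟩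
                    3 + n N ≤⟨ 3+nN≤m ⟩
                    m       ≤⟨ m≤ℓ[m] m ⟩
                    ℓ m     ≡⟨ ni≡ℓ ⟨
                    n i     ∎)
                    where open ≤-Reasoning

      above⇒¬RatioBelow1+√3 : DeltaAboveSqrt3 n → ∀ K M → ¬ (∀ m → M ≤ m → RatioBelow1+√3 K (q m) (q (suc m)))
      above⇒¬RatioBelow1+√3 (p , d , _ , 3d²<p² , often) K M bound = at (often (i₀ + ℓ M′))
        where
          B M′ e : ℕ
          B = (K + 20) * (d * d)
          M′ = M + suc B
          e = p ∸ d
          d+e≡p : d + e ≡ p
          d+e≡p = m+[n∸m]≡n (<⇒≤ (3d²<p²⇒d<p p d 3d²<p²))
          at : (∃ λ i → i₀ + ℓ M′ ≤ i × p * n i < d * n (suc i)) → ⊥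
          at (i , N≤i , pn<dn′) = step (eventually-gridStep M′ i N≤i)
            where
              step : GridStep M′ i → ⊥
              step (m , k , M′≤m , 3≤m , ni≡π , n[1+i]≡π) = <⇒≱ B<q (ratio-above-√3⇒bounded K (q m) (q (suc m)) d e
                  (subst (λ p → 3 * (d * d) < p * p) (sym d+e≡p) 3d²<p²)
                  (≤-trans (≤-trans (n≤1+n 2) 3≤m) (m≤q[m] m))
                  (bound m (≤-trans (m≤m+n M (suc B)) M′≤m))
                  (transition⇒ratio-above d e (π m k) (ℓ m) (q m) (q (suc m)) (m≤n+m (ℓ m) (k * q (suc m))) (ℓ+2≡q+q m)
                    (subst (λ p → p * π m k < d * (π m k + q (suc m))) (sym d+e≡p)
                      (subst₂ (λ x y → p * x < d * y) ni≡π (trans n[1+i]≡π (π-suc m k)) pn<dn′))))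
                where
                  B<q : B < q (suc m)
                  B<q = ≤-trans (m≤n+m (suc B) M) (≤-trans M′≤m (≤-trans (n≤1+n m) (m≤q[m] (suc m))))

sturmian-¬DeltaInInterval : ∀ (s : ℕ → ℕ) (w : ℕ → Bool) → (∀ k → 0 < s (suc k)) → IsCharSturmian s w →
                            ∀ n → IsPalPrefixLengths w n → ¬ DeltaInInterval n
sturmian-¬DeltaInInterval s w s-pos w-lim n E (above , below) =
  let M , ratio = below⇒RatioBelowξ below
      K , bound = s≤2⇒RatioBelow1+√3 (RatioBelowξ⇒s≤2 ratio)
  in above⇒¬RatioBelow1+√3 above K M bound
  where
    open CharacteristicSturmian s s-pos
    open Limit w-lim
    open Enumeration E

proposition7p7 :
    (∀ {A : Set} (u : List A) (w : ℕ → A) → IsPalPeriodic u w →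
       ∀ (n : ℕ → ℕ) → IsPalPrefixLengths w n → ¬ DeltaInInterval n)
    × (∀ (s : ℕ → ℕ) (w : ℕ → Bool) → (∀ k → 0 < s (suc k)) →
       IsCharSturmian s w →
       ∀ (n : ℕ → ℕ) → IsPalPrefixLengths w n → ¬ DeltaInInterval n)
proposition7p7 = palPeriodic-¬DeltaInInterval , sturmian-¬DeltaInInterval
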